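{- Let $L:\mathbb{F}_{2^n}\to\mathbb{F}_{2^n}$ be the $\mathbb{F}_2$-linear function $L(x)=\sum_{i=0}^{n-1}c_ix^{2^i}$ with $c_i\in\mathbb{F}_{2^n}$. Then $L$ is invertible and satisfies $L=(L^{ -1})^*$ if and only if $$\sum_{i=0}^{n-1}c_i^{2^{n-i}}=1\quad\text{and}\quad\sum_{i=0}^{n-1}(c_ic_{i+j})^{2^{n-i}}=0\ \text{ for all } j\in\{1,\dots,n-1\},$$ where indices of the $c$'s are taken modulo $n$.
   Context: $\mathrm{Tr}:\mathbb{F}_{2^n}\to\mathbb{F}_2$ is the absolute trace. For an $\mathbb{F}_2$-linear map $M$ on $\mathbb{F}_{2^n}$, $M^*$ denotes its adjoint with respect to the bilinear form $(u,v)\mapsto\mathrm{Tr}(uv)$, i.e. the $\mathbb{F}_2$-linear map with $\mathrm{Tr}(M(u)v)=\mathrm{Tr}(uM^*(v))$ for all $u,v\in\mathbb{F}_{2^n}$. -}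

module Defs where

open import Level using (Level; _⊔_) renaming (suc to lsuc)
open import Data.Nat using (ℕ; zero; suc; _∸_; _^_; NonZero; _≤_; _<_) renaming (_+_ to _+ℕ_)
open import Data.Nat.DivMod using (_%_; m%n<n)
open import Data.Fin using (Fin; fromℕ<)
open import Data.Product using (∃; _×_)
open import Relation.Nullary using (¬_)
open import Algebra.Bundles using (CommutativeRing)
open import Function.Bundles using (Bijection)
import Relation.Binary.PropositionalEquality as ≡

record FiniteField2^ (n : ℕ) (c ℓ : Level) : Set (lsuc (c ⊔ ℓ)) where
  field
    commRing : CommutativeRing c ℓ
  open CommutativeRing commRing public
  field
    nontrivial : ¬ (1# ≈ 0#)
    invertible : ∀ x → ¬ (x ≈ 0#) → ∃ λ y → x * y ≈ 1#
    card       : Bijection (≡.setoid (Fin (2 ^ n))) setoid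

module FieldOps {n : ℕ} {c ℓ : Level} (F : FiniteField2^ n c ℓ) where
  open FiniteField2^ F

  pow : Carrier → ℕ → Carrier
  pow x zero    = 1#
  pow x (suc k) = x * pow x k

  sumTo : ℕ → (ℕ → Carrier) → Carrier
  sumTo zero    f = 0#
  sumTo (suc m) f = sumTo m f + f m

  Tr : Carrier → Carrier
  Tr x = sumTo n (λ i → pow x (2 ^ i))

  modIdx : .{{_ : NonZero n}} → ℕ → Fin n
  modIdx k = fromℕ< (m%n<n k n)

  linPoly : .{{_ : NonZero n}} → (Fin n → Carrier) → Carrier → Carrier
  linPoly cs x = sumTo n (λ i → cs (modIdx i) * pow x (2 ^ i))

  -- L is invertible (two-sided inverse Linv) and L = (Linv)^*, i.e.
  -- Tr(Linv(u) v) = Tr(u L(v)) for all u, v.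
  InvertibleAndSelfAdjointInverse : (Carrier → Carrier) → Set (c ⊔ ℓ)
  InvertibleAndSelfAdjointInverse L =
    ∃ λ (Linv : Carrier → Carrier) →
      (∀ x → L (Linv x) ≈ x) × (∀ x → Linv (L x) ≈ x) ×
      (∀ u v → Tr (Linv u * v) ≈ Tr (u * L v))

  CoeffConditions : .{{_ : NonZero n}} → (Fin n → Carrier) → Set ℓ
  CoeffConditions cs =
    (sumTo n (λ i → pow (cs (modIdx i)) (2 ^ (n ∸ i))) ≈ 1#) ×
    (∀ j → 1 ≤ j → j < n →
      sumTo n (λ i → pow (cs (modIdx i) * cs (modIdx (i +ℕ j))) (2 ^ (n ∸ i))) ≈ 0#)

module Submission where

-- Because the trace is Frobenius-invariant, L*(u) = Σ_k (c_k u)^(2^(n-k)) is the adjoint of L for the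
-- form Tr(uv). The form is nondegenerate (a nonzero linearized polynomial of degree < 2^n cannot vanish
-- on all of F), so an inverse of L with L = (L⁻¹)* must be L*, and since F is finite this happens exactly
-- when L* ∘ L = id. Expanding with the Frobenius, L*(L x) = Σ_j b_j x^(2^j) with
-- b_j = Σ_i (c_i c_(i+j))^(2^(n-i)), so by the same degree argument L* ∘ L = id iff b_0 = 1 and b_j = 0
-- for 0 < j < n; finally b_0 is the square of Σ_i c_i^(2^(n-i)), and squaring is injective.

open import Level using (Level; _⊔_)
open import Defs
open import Data.Nat.DivMod using ([m+n]%n≡m%n)
open import Data.Nat as ℕ using (ℕ; zero; suc; _≤_; _<_; s≤s; z≤n; NonZero)
open import Data.Fin using (Fin) renaming (zero to fzero; suc to fsuc)
import Data.Fin.Properties as Fin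
import Data.Nat.Properties as ℕₚ
open import Function.Bundles using (Bijection; _⇔_; mk⇔)
open import Function.Properties.Equivalence using () renaming (trans to ⇔-trans; sym to ⇔-sym)
open import Data.List using (List; []; _∷_; length)
open import Data.List.Relation.Unary.All using (All; []; _∷_)
open import Data.Product using (∃; _×_; _,_; proj₁; proj₂)
open import Data.Sum using (_⊎_; inj₁; inj₂; [_,_]′)
open import Data.Empty using (⊥-elim)
open import Relation.Nullary using (Dec; yes; no)
import Relation.Nullary.Decidable as Dec
open import Relation.Binary.PropositionalEquality as ≡ using (_≡_; _≢_)
open import Function using (_∘_; id)
open import Function.Definitions using (Congruent)
open import Data.Fin.Permutation using (Permutation; permutation)
open import Algebra.Bundles using (CommutativeRing)
import Algebra.Properties.Semiring.Exp as Exp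
import Algebra.Properties.Group as GroupProperties
import Tactic.RingSolver.Core.AlmostCommutativeRing as ACR
open import Tactic.RingSolver using (solve-∀)
open import Data.Maybe using (nothing)

module CommutativeRingIdentities {c ℓ} (R : CommutativeRing c ℓ) where
  private
    acr : ACR.AlmostCommutativeRing c ℓ
    acr = ACR.fromCommutativeRing R (λ _ → nothing)
  open ACR.AlmostCommutativeRing acr

  division-rearrangement : ∀ a r s d x q → (a + r * s) + d * (s + x * q) ≈ a + ((d + r) * s + x * (d * q))
  division-rearrangement = solve-∀ acr

  square-expansion : ∀ x y → (x + y) * (x + y) ≈ (x * x + y * y) + (x * y + x * y)
  square-expansion = solve-∀ acr

module ListPolynomial {c ℓ} (R : CommutativeRing c ℓ) where
  open CommutativeRing R
  open Exp semiring using (_^_)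
  open CommutativeRingIdentities R using (division-rearrangement)
  open import Algebra.Properties.CommutativeSemigroup +-commutativeSemigroup using () renaming (interchange to +-interchange)
  open import Algebra.Properties.CommutativeSemigroup *-commutativeSemigroup using () renaming (x∙yz≈y∙xz to x*[y*z]≈y*[x*z])
  open GroupProperties +-group using (x∙y⁻¹≈ε⇒x≈y; //-rightDividesˡ)
  open import Relation.Binary.Reasoning.Setoid setoid

  Poly : Set c
  Poly = List Carrier

  eval : Poly → Carrier → Carrier
  eval []      x = 0#
  eval (a ∷ p) x = a + x * eval p x

  IsZero : Poly → Set (c ⊔ ℓ)
  IsZero = All (_≈ 0#)

  divide : Carrier → Carrier → Poly → Poly × Carrier
  divide r a []      = [] , a
  divide r a (b ∷ p) = (proj₂ (divide r b p) ∷ proj₁ (divide r b p)) , a + r * proj₂ (divide r b p)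

  length-quotient : ∀ r a p → length (proj₁ (divide r a p)) ≡ length p
  length-quotient r a []      = ≡.refl
  length-quotient r a (b ∷ p) = ≡.cong suc (length-quotient r b p)

  eval-divide : ∀ r a p x → let (quot , rem) = divide r a p in eval (a ∷ p) x ≈ rem + (x - r) * eval quot x
  eval-divide r a []      x = +-congˡ (trans (zeroʳ x) (sym (zeroʳ (x - r))))
  eval-divide r a (b ∷ p) x = begin
    a + x * eval (b ∷ p) x                  ≈⟨ +-congˡ (*-congˡ (eval-divide r b p x)) ⟩
    a + x * (s + (x - r) * q)               ≈⟨ +-congˡ (distribˡ x s _) ⟩
    a + (x * s + x * ((x - r) * q))         ≈⟨ +-congˡ (+-congʳ (*-congʳ (//-rightDividesˡ r x))) ⟨
    a + ((x - r + r) * s + x * ((x - r) * q)) ≈⟨ division-rearrangement a r s (x - r) x q ⟨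
    (a + r * s) + (x - r) * (s + x * q)     ∎
    where
    s = proj₂ (divide r b p)
    q = eval (proj₁ (divide r b p)) x

  divide-zero : ∀ r a p → let (quot , rem) = divide r a p in IsZero quot → rem ≈ 0# → IsZero (a ∷ p)
  divide-zero r a []      _             rem≈0 = rem≈0 ∷ []
  divide-zero r a (b ∷ p) (s≈0 ∷ quot≈0) rem≈0 =
    trans (sym (+-identityʳ a)) (trans (+-congˡ (sym (trans (*-congˡ s≈0) (zeroʳ r)))) rem≈0)
    ∷ divide-zero r b p quot≈0 s≈0

  NoZeroDivisors : Set (c ⊔ ℓ)
  NoZeroDivisors = ∀ {x y} → x * y ≈ 0# → x ≈ 0# ⊎ y ≈ 0#

  vanishing⇒zero : NoZeroDivisors → ∀ {k} (pts : Fin k → Carrier) → (∀ {i j} → pts i ≈ pts j → i ≡ j) →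
                   ∀ p → length p ≤ k → (∀ i → eval p (pts i) ≈ 0#) → IsZero p
  vanishing⇒zero noZeroDiv pts inj []      _         _        = []
  vanishing⇒zero noZeroDiv {suc k} pts inj (a ∷ p) (s≤s len) vanishes =
    divide-zero r a p (vanishing⇒zero noZeroDiv (pts ∘ fsuc) (Fin.suc-injective ∘ inj) quot
                        (≡.subst (_≤ k) (≡.sym (length-quotient r a p)) len) quot-vanishes)
                      rem≈0
    where
    r = pts fzero
    quot = proj₁ (divide r a p)
    rem = proj₂ (divide r a p)
    rem≈0 : rem ≈ 0#
    rem≈0 = begin
      rem                         ≈⟨ +-identityʳ rem ⟨
      rem + 0#                    ≈⟨ +-congˡ (trans (*-congʳ (-‿inverseʳ r)) (zeroˡ _)) ⟨
      rem + (r - r) * eval quot r ≈⟨ eval-divide r a p r ⟨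
      eval (a ∷ p) r              ≈⟨ vanishes fzero ⟩
      0#                          ∎
    quot-vanishes : ∀ i → eval quot (pts (fsuc i)) ≈ 0#
    quot-vanishes i = [ (λ s-r≈0 → ⊥-elim (Fin.0≢1+n (inj (sym (x∙y⁻¹≈ε⇒x≈y s r s-r≈0))))) , id ]′ (noZeroDiv product≈0)
      where
      s = pts (fsuc i)
      product≈0 : (s - r) * eval quot s ≈ 0#
      product≈0 = begin
        (s - r) * eval quot s       ≈⟨ +-identityˡ _ ⟨
        0# + (s - r) * eval quot s  ≈⟨ +-congʳ rem≈0 ⟨
        rem + (s - r) * eval quot s ≈⟨ eval-divide r a p s ⟨
        eval (a ∷ p) s              ≈⟨ vanishes (fsuc i) ⟩
        0#                          ∎

  infixl 6 _⊕_
  _⊕_ : Poly → Poly → Poly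
  []      ⊕ p'       = p'
  (a ∷ p) ⊕ []       = a ∷ p
  (a ∷ p) ⊕ (b ∷ p') = a + b ∷ p ⊕ p'

  eval-⊕ : ∀ p p' x → eval (p ⊕ p') x ≈ eval p x + eval p' x
  eval-⊕ []      p'       x = sym (+-identityˡ _)
  eval-⊕ (a ∷ p) []       x = sym (+-identityʳ _)
  eval-⊕ (a ∷ p) (b ∷ p') x = begin
    (a + b) + x * eval (p ⊕ p') x               ≈⟨ +-congˡ (trans (*-congˡ (eval-⊕ p p' x)) (distribˡ x _ _)) ⟩
    (a + b) + (x * eval p x + x * eval p' x)    ≈⟨ +-interchange a b _ _ ⟩
    (a + x * eval p x) + (b + x * eval p' x)    ∎

  length-⊕ : ∀ {m} p p' → length p ≤ m → length p' ≤ m → length (p ⊕ p') ≤ m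
  length-⊕ []      p'       _         l'        = l'
  length-⊕ (a ∷ p) []       l         _         = l
  length-⊕ (a ∷ p) (b ∷ p') (s≤s l)   (s≤s l')  = s≤s (length-⊕ p p' l l')

  infix 8 _·X^_
  _·X^_ : Carrier → ℕ → Poly
  a ·X^ zero  = a ∷ []
  a ·X^ suc k = 0# ∷ a ·X^ k

  eval-·X^ : ∀ a k x → eval (a ·X^ k) x ≈ a * x ^ k
  eval-·X^ a zero    x = trans (+-congˡ (zeroʳ x)) (trans (+-identityʳ a) (sym (*-identityʳ a)))
  eval-·X^ a (suc k) x = begin
    0# + x * eval (a ·X^ k) x ≈⟨ +-identityˡ _ ⟩
    x * eval (a ·X^ k) x      ≈⟨ *-congˡ (eval-·X^ a k x) ⟩
    x * (a * x ^ k)           ≈⟨ x*[y*z]≈y*[x*z] x a _ ⟩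
    a * (x * x ^ k)           ∎

  length-·X^ : ∀ a k → length (a ·X^ k) ≡ suc k
  length-·X^ a zero    = ≡.refl
  length-·X^ a (suc k) = ≡.cong suc (length-·X^ a k)

  coeff : Poly → ℕ → Carrier
  coeff []      t       = 0#
  coeff (a ∷ p) zero    = a
  coeff (a ∷ p) (suc t) = coeff p t

  coeff-⊕ : ∀ p p' t → coeff (p ⊕ p') t ≈ coeff p t + coeff p' t
  coeff-⊕ []      p'       t       = sym (+-identityˡ _)
  coeff-⊕ (a ∷ p) []       zero    = sym (+-identityʳ _)
  coeff-⊕ (a ∷ p) []       (suc t) = sym (+-identityʳ _)
  coeff-⊕ (a ∷ p) (b ∷ p') zero    = refl
  coeff-⊕ (a ∷ p) (b ∷ p') (suc t) = coeff-⊕ p p' t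

  coeff-·X^-≡ : ∀ a k → coeff (a ·X^ k) k ≈ a
  coeff-·X^-≡ a zero    = refl
  coeff-·X^-≡ a (suc k) = coeff-·X^-≡ a k

  coeff-·X^-≢ : ∀ a {k t} → t ≢ k → coeff (a ·X^ k) t ≈ 0#
  coeff-·X^-≢ a {zero}  {zero}  t≢k = ⊥-elim (t≢k ≡.refl)
  coeff-·X^-≢ a {zero}  {suc t} _   = refl
  coeff-·X^-≢ a {suc k} {zero}  _   = refl
  coeff-·X^-≢ a {suc k} {suc t} t≢k = coeff-·X^-≢ a (t≢k ∘ ≡.cong suc)

  coeff-beyond-length : ∀ p {t} → length p ≤ t → coeff p t ≈ 0#
  coeff-beyond-length []      _       = refl
  coeff-beyond-length (a ∷ p) (s≤s l) = coeff-beyond-length p l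

  coeff-IsZero : ∀ {p} → IsZero p → ∀ t → coeff p t ≈ 0#
  coeff-IsZero []            t       = refl
  coeff-IsZero (a≈0 ∷ _)     zero    = a≈0
  coeff-IsZero (_ ∷ p≈0)     (suc t) = coeff-IsZero p≈0 t

Fin-injective⇒surjective : ∀ {m} (f : Fin m → Fin m) → (∀ {i j} → f i ≡ f j → i ≡ j) → ∀ j → ∃ λ i → f i ≡ j
Fin-injective⇒surjective {m} f inj j with Fin.any? (λ i → f i Fin.≟ j)
... | yes hit = hit
Fin-injective⇒surjective {suc m} f inj j | no miss =
  ⊥-elim (ℕₚ.1+n≰n (Fin.injective⇒≤ (λ e → inj (Fin.punchOut-injective (f≢j _) (f≢j _) e))))
  where
  f≢j : ∀ i → j ≢ f i
  f≢j i e = miss (i , ≡.sym e)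

module FiniteField2^Properties {n : ℕ} {c ℓ : Level} (F : FiniteField2^ n c ℓ) where
  open FiniteField2^ F
  open FieldOps F
  open import Relation.Binary.Reasoning.Setoid setoid
  open Exp semiring using (_^_; ^-congˡ; ^-assocʳ)
  open import Algebra.Properties.CommutativeSemiring.Exp commutativeSemiring using (^-distrib-*)
  open ListPolynomial commRing
  open CommutativeRingIdentities commRing using (square-expansion)
  open import Algebra.Properties.Ring ring using (-1*x≈-x; -‿involutive)
  open GroupProperties +-group using (x∙y⁻¹≈ε⇒x≈y)
  open import Algebra.Properties.CommutativeSemigroup +-commutativeSemigroup using () renaming (interchange to +-interchange)
  open import Algebra.Properties.CommutativeMonoid.Sum *-commutativeMonoid
    using () renaming ( sum to product; sum-cong-≋ to product-cong; sum-replicate to product-replicate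
                      ; sum-permute to product-permute; ∑-distrib-+ to product-distrib)

  q : ℕ
  q = 2 ℕ.^ n

  open Bijection card using () renaming (to to element; injective to element-injective; surjective to element-surjective)

  index : Carrier → Fin q
  index y = proj₁ (element-surjective y)

  element-index : ∀ y → element (index y) ≈ y
  element-index y = proj₂ (element-surjective y) ≡.refl

  index-cong : ∀ {x y} → x ≈ y → index x ≡ index y
  index-cong {x} {y} x≈y = element-injective (trans (element-index x) (trans x≈y (sym (element-index y))))

  index-element : ∀ i → index (element i) ≡ i
  index-element i = element-injective (element-index (element i))

  _≟_ : ∀ x y → Dec (x ≈ y)
  x ≟ y = Dec.map′ from index-cong (index x Fin.≟ index y)
    where
    from : index x ≡ index y → x ≈ y
    from e = trans (sym (element-index x)) (trans (reflexive (≡.cong element e)) (element-index y))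

  injective⇒surjective : ∀ (f : Carrier → Carrier) → Congruent _≈_ _≈_ f → (∀ {x y} → f x ≈ f y → x ≈ y) →
                         ∀ y → ∃ λ x → f x ≈ y
  injective⇒surjective f f-cong f-inj y with Fin-injective⇒surjective f̂ f̂-inj (index y)
    where
    f̂ : Fin q → Fin q
    f̂ i = index (f (element i))
    f̂-inj : ∀ {i j} → f̂ i ≡ f̂ j → i ≡ j
    f̂-inj e = element-injective (f-inj (trans (sym (element-index _)) (trans (reflexive (≡.cong element e)) (element-index _))))
  ... | i , f̂i≡y = element i , trans (sym (element-index _)) (trans (reflexive (≡.cong element f̂i≡y)) (element-index y))

  *-cancelʳ-nonzero : ∀ {x y z} → z ≉ 0# → x * z ≈ y * z → x ≈ y
  *-cancelʳ-nonzero {x} {y} {z} z≉0 xz≈yz with invertible z z≉0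
  ... | z⁻¹ , zz⁻¹≈1 = begin
    x              ≈⟨ *-identityʳ x ⟨
    x * 1#         ≈⟨ *-congˡ zz⁻¹≈1 ⟨
    x * (z * z⁻¹)  ≈⟨ *-assoc x z z⁻¹ ⟨
    x * z * z⁻¹    ≈⟨ *-congʳ xz≈yz ⟩
    y * z * z⁻¹    ≈⟨ *-assoc y z z⁻¹ ⟩
    y * (z * z⁻¹)  ≈⟨ *-congˡ zz⁻¹≈1 ⟩
    y * 1#         ≈⟨ *-identityʳ y ⟩
    y              ∎

  noZeroDivisors : NoZeroDivisors
  noZeroDivisors {x} {y} xy≈0 with x ≟ 0#
  ... | yes x≈0 = inj₁ x≈0
  ... | no  x≉0 = inj₂ (*-cancelʳ-nonzero x≉0 (trans (*-comm y x) (trans xy≈0 (sym (zeroˡ x)))))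

  *-nonzero : ∀ {x y} → x ≉ 0# → y ≉ 0# → x * y ≉ 0#
  *-nonzero x≉0 y≉0 xy≈0 = [ x≉0 , y≉0 ]′ (noZeroDivisors xy≈0)

  pow≈^ : ∀ x k → pow x k ≈ x ^ k
  pow≈^ x zero    = refl
  pow≈^ x (suc k) = *-congˡ (pow≈^ x k)

  pow-cong : ∀ k {x y} → x ≈ y → pow x k ≈ pow y k
  pow-cong zero    x≈y = refl
  pow-cong (suc k) x≈y = *-cong x≈y (pow-cong k x≈y)

  pow-distrib-* : ∀ x y k → pow (x * y) k ≈ pow x k * pow y k
  pow-distrib-* x y k = begin
    pow (x * y) k       ≈⟨ pow≈^ (x * y) k ⟩
    (x * y) ^ k         ≈⟨ ^-distrib-* x y k ⟩
    x ^ k * y ^ k       ≈⟨ *-cong (pow≈^ x k) (pow≈^ y k) ⟨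
    pow x k * pow y k   ∎

  pow-pow : ∀ x a b → pow (pow x a) b ≈ pow x (a ℕ.* b)
  pow-pow x a b = begin
    pow (pow x a) b  ≈⟨ pow≈^ (pow x a) b ⟩
    pow x a ^ b      ≈⟨ ^-congˡ b (pow≈^ x a) ⟩
    (x ^ a) ^ b      ≈⟨ ^-assocʳ x a b ⟩
    x ^ (a ℕ.* b)    ≈⟨ pow≈^ x (a ℕ.* b) ⟨
    pow x (a ℕ.* b)  ∎

  pow-nonzero : ∀ {x} k → x ≉ 0# → pow x k ≉ 0#
  pow-nonzero zero    x≉0 = nontrivial
  pow-nonzero (suc k) x≉0 = *-nonzero x≉0 (pow-nonzero k x≉0)

  pow-0# : ∀ k → 1 ≤ k → pow 0# k ≈ 0#
  pow-0# (suc k) _ = zeroˡ (pow 0# k)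

  pow-1# : ∀ k → pow 1# k ≈ 1#
  pow-1# zero    = refl
  pow-1# (suc k) = trans (*-identityˡ _) (pow-1# k)

  product-nonzero : ∀ {m} (t : Fin m → Carrier) → (∀ i → t i ≉ 0#) → product t ≉ 0#
  product-nonzero {zero}  t _      = nontrivial
  product-nonzero {suc m} t t≉0 = *-nonzero (t≉0 fzero) (product-nonzero (t ∘ fsuc) (t≉0 ∘ fsuc))

  product-all-but-one : ∀ {m} a (t : Fin m → Carrier) j → t j ≈ 1# → (∀ i → i ≢ j → t i ≈ a) → product t * a ≈ a ^ m
  product-all-but-one {suc m} a t fzero tj≈1 t≈a = begin
    t fzero * product (t ∘ fsuc) * a ≈⟨ *-congʳ (*-cong tj≈1 (trans (product-cong (λ i → t≈a (fsuc i) λ ())) (product-replicate m))) ⟩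
    1# * a ^ m * a                   ≈⟨ *-congʳ (*-identityˡ _) ⟩
    a ^ m * a                        ≈⟨ *-comm _ a ⟩
    a * a ^ m                        ∎
  product-all-but-one {suc m} a t (fsuc j) tj≈1 t≈a = begin
    t fzero * product (t ∘ fsuc) * a   ≈⟨ *-assoc _ _ a ⟩
    t fzero * (product (t ∘ fsuc) * a) ≈⟨ *-cong (t≈a fzero λ ()) (product-all-but-one a (t ∘ fsuc) j tj≈1 (λ i i≢j → t≈a (fsuc i) (i≢j ∘ Fin.suc-injective))) ⟩
    a * a ^ m                          ∎

  ∏ : (Carrier → Carrier) → Carrier
  ∏ g = product (g ∘ element)

  ∏-reindex : ∀ (φ ψ : Carrier → Carrier) → Congruent _≈_ _≈_ φ → Congruent _≈_ _≈_ ψ →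
              (∀ x → φ (ψ x) ≈ x) → (∀ x → ψ (φ x) ≈ x) →
              ∀ g → Congruent _≈_ _≈_ g → ∏ g ≈ ∏ (g ∘ φ)
  ∏-reindex φ ψ φ-cong ψ-cong φψ ψφ g g-cong =
    trans (product-permute (g ∘ element) π) (product-cong (λ i → g-cong (element-index (φ (element i)))))
    where
    π : Permutation q q
    π = permutation (λ i → index (φ (element i))) (λ i → index (ψ (element i)))
          (λ i → element-injective (trans (element-index _) (trans (φ-cong (element-index _)) (φψ (element i)))))
          (λ i → element-injective (trans (element-index _) (trans (ψ-cong (element-index _)) (ψφ (element i)))))

  ifNonzero : Carrier → Carrier → Carrier
  ifNonzero x a with x ≟ 0#
  ... | yes _ = 1#
  ... | no  _ = a

  ifNonzero-zero : ∀ {x} a → x ≈ 0# → ifNonzero x a ≈ 1#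
  ifNonzero-zero {x} a x≈0 with x ≟ 0#
  ... | yes _   = refl
  ... | no  x≉0 = ⊥-elim (x≉0 x≈0)

  ifNonzero-nonzero : ∀ {x} a → x ≉ 0# → ifNonzero x a ≈ a
  ifNonzero-nonzero {x} a x≉0 with x ≟ 0#
  ... | yes x≈0 = ⊥-elim (x≉0 x≈0)
  ... | no  _   = refl

  ifNonzero-cong : ∀ {x y a b} → x ≈ y → a ≈ b → ifNonzero x a ≈ ifNonzero y b
  ifNonzero-cong {x} {y} {a} {b} x≈y a≈b with x ≟ 0#
  ... | yes x≈0 = sym (ifNonzero-zero b (trans (sym x≈y) x≈0))
  ... | no  x≉0 = trans a≈b (sym (ifNonzero-nonzero b (x≉0 ∘ trans x≈y)))

  ifNonzero-self-nonzero : ∀ x → ifNonzero x x ≉ 0#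
  ifNonzero-self-nonzero x with x ≟ 0#
  ... | yes _   = nontrivial
  ... | no  x≉0 = x≉0

  ifNonzero-self-* : ∀ {a} → a ≉ 0# → ∀ x → ifNonzero (a * x) (a * x) ≈ ifNonzero x a * ifNonzero x x
  ifNonzero-self-* {a} a≉0 x with x ≟ 0#
  ... | yes x≈0 = trans (ifNonzero-zero _ (trans (*-congˡ x≈0) (zeroʳ a))) (sym (*-identityˡ 1#))
  ... | no  x≉0 = ifNonzero-nonzero _ (*-nonzero a≉0 x≉0)

  -- the nonzero elements are permuted by  x ↦ a x , so their product P satisfies  a^(q-1) P ≈ P
  fermat : ∀ a → pow a q ≈ a
  fermat a with a ≟ 0#
  ... | yes a≈0 = trans (pow-cong q a≈0) (trans (pow-0# q (ℕₚ.m^n>0 2 n)) (sym a≈0))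
  ... | no  a≉0 with invertible a a≉0
  ... | a⁻¹ , aa⁻¹≈1 = begin
    pow a q                   ≈⟨ pow≈^ a q ⟩
    a ^ q                     ≈⟨ product-all-but-one a (scale ∘ element) (index 0#) (ifNonzero-zero a (element-index 0#)) scale≈a ⟨
    ∏ scale * a               ≈⟨ *-congʳ (*-cancelʳ-nonzero P≉0 ∏scale*P≈1*P) ⟩
    1# * a                    ≈⟨ *-identityˡ a ⟩
    a                         ∎
    where
    scale : Carrier → Carrier
    scale x = ifNonzero x a
    scale≈a : ∀ i → i ≢ index 0# → scale (element i) ≈ a
    scale≈a i i≢0 = ifNonzero-nonzero a (λ e → i≢0 (≡.trans (≡.sym (index-element i)) (index-cong e)))
    orOne : Carrier → Carrier
    orOne x = ifNonzero x x
    P : Carrier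
    P = ∏ orOne
    P≉0 : P ≉ 0#
    P≉0 = product-nonzero (orOne ∘ element) (ifNonzero-self-nonzero ∘ element)
    ∏scale*P≈1*P : ∏ scale * P ≈ 1# * P
    ∏scale*P≈1*P = begin
      ∏ scale * P                 ≈⟨ product-distrib (scale ∘ element) (orOne ∘ element) ⟨
      ∏ (λ x → scale x * orOne x) ≈⟨ product-cong (ifNonzero-self-* a≉0 ∘ element) ⟨
      ∏ (λ x → orOne (a * x))     ≈⟨ ∏-reindex (a *_) (a⁻¹ *_) *-congˡ *-congˡ cancel cancel′ orOne (λ e → ifNonzero-cong e e) ⟨
      P                           ≈⟨ *-identityˡ P ⟨
      1# * P                      ∎
      where
      cancel : ∀ x → a * (a⁻¹ * x) ≈ x
      cancel x = trans (sym (*-assoc a a⁻¹ x)) (trans (*-congʳ aa⁻¹≈1) (*-identityˡ x))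
      cancel′ : ∀ x → a⁻¹ * (a * x) ≈ x
      cancel′ x = trans (sym (*-assoc a⁻¹ a x)) (trans (*-congʳ (trans (*-comm a⁻¹ a) aa⁻¹≈1)) (*-identityˡ x))

  sumTo-cong : ∀ m {f g : ℕ → Carrier} → (∀ i → i < m → f i ≈ g i) → sumTo m f ≈ sumTo m g
  sumTo-cong zero    f≈g = refl
  sumTo-cong (suc m) f≈g = +-cong (sumTo-cong m (λ i i<m → f≈g i (ℕₚ.m<n⇒m<1+n i<m))) (f≈g m ℕₚ.≤-refl)

  sumTo-zero : ∀ m {f : ℕ → Carrier} → (∀ i → i < m → f i ≈ 0#) → sumTo m f ≈ 0#
  sumTo-zero zero    f≈0 = refl
  sumTo-zero (suc m) f≈0 =
    trans (+-cong (sumTo-zero m (λ i i<m → f≈0 i (ℕₚ.m<n⇒m<1+n i<m))) (f≈0 m ℕₚ.≤-refl)) (+-identityʳ 0#)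

  sumTo-head : ∀ m .{{_ : NonZero m}} {f : ℕ → Carrier} → (∀ i → 1 ≤ i → i < m → f i ≈ 0#) → sumTo m f ≈ f 0
  sumTo-head (suc zero)    f≈0 = +-identityˡ _
  sumTo-head (suc (suc m)) f≈0 =
    trans (+-cong (sumTo-head (suc m) (λ i 1≤i i<m → f≈0 i 1≤i (ℕₚ.m<n⇒m<1+n i<m))) (f≈0 (suc m) (s≤s z≤n) ℕₚ.≤-refl))
          (+-identityʳ _)

  sumTo-+ : ∀ m (f g : ℕ → Carrier) → sumTo m (λ i → f i + g i) ≈ sumTo m f + sumTo m g
  sumTo-+ zero    f g = sym (+-identityˡ 0#)
  sumTo-+ (suc m) f g = trans (+-congʳ (sumTo-+ m f g)) (+-interchange _ _ _ _)

  *-distribˡ-sumTo : ∀ m a (f : ℕ → Carrier) → a * sumTo m f ≈ sumTo m (λ i → a * f i)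
  *-distribˡ-sumTo zero    a f = zeroʳ a
  *-distribˡ-sumTo (suc m) a f = trans (distribˡ a _ _) (+-congʳ (*-distribˡ-sumTo m a f))

  *-distribʳ-sumTo : ∀ m a (f : ℕ → Carrier) → sumTo m f * a ≈ sumTo m (λ i → f i * a)
  *-distribʳ-sumTo zero    a f = zeroˡ a
  *-distribʳ-sumTo (suc m) a f = trans (distribʳ a _ _) (+-congʳ (*-distribʳ-sumTo m a f))

  sumTo-split : ∀ a b (f : ℕ → Carrier) → sumTo (a ℕ.+ b) f ≈ sumTo a f + sumTo b (λ t → f (a ℕ.+ t))
  sumTo-split a zero    f = trans (reflexive (≡.cong (λ m → sumTo m f) (ℕₚ.+-identityʳ a))) (sym (+-identityʳ _))
  sumTo-split a (suc b) f = begin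
    sumTo (a ℕ.+ suc b) f                                          ≡⟨ ≡.cong (λ m → sumTo m f) (ℕₚ.+-suc a b) ⟩
    sumTo (a ℕ.+ b) f + f (a ℕ.+ b)                                ≈⟨ +-congʳ (sumTo-split a b f) ⟩
    sumTo a f + sumTo b (λ t → f (a ℕ.+ t)) + f (a ℕ.+ b)          ≈⟨ +-assoc _ _ _ ⟩
    sumTo a f + sumTo (suc b) (λ t → f (a ℕ.+ t))                  ∎

  sumTo-swap : ∀ m k (f : ℕ → ℕ → Carrier) → sumTo m (λ i → sumTo k (f i)) ≈ sumTo k (λ j → sumTo m (λ i → f i j))
  sumTo-swap zero    k f = sym (sumTo-zero k (λ _ _ → refl))
  sumTo-swap (suc m) k f = trans (+-congʳ (sumTo-swap m k f)) (sym (sumTo-+ k _ (f m)))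

  sumTo-rotate : ∀ m k (f : ℕ → Carrier) → k ≤ m → (∀ i → f (m ℕ.+ i) ≈ f i) →
                 sumTo m (λ i → f (k ℕ.+ i)) ≈ sumTo m f
  sumTo-rotate m k f k≤m periodic = begin
    sumTo m (λ i → f (k ℕ.+ i))                                     ≡⟨ ≡.cong (λ l → sumTo l _) (ℕₚ.m∸n+n≡m k≤m) ⟨
    sumTo (d ℕ.+ k) (λ i → f (k ℕ.+ i))                             ≈⟨ sumTo-split d k _ ⟩
    sumTo d (λ i → f (k ℕ.+ i)) + sumTo k (λ t → f (k ℕ.+ (d ℕ.+ t))) ≈⟨ +-congˡ (sumTo-cong k (λ t _ → wrap t)) ⟩
    sumTo d (λ i → f (k ℕ.+ i)) + sumTo k f                         ≈⟨ +-comm _ _ ⟩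
    sumTo k f + sumTo d (λ i → f (k ℕ.+ i))                         ≈⟨ sumTo-split k d f ⟨
    sumTo (k ℕ.+ d) f                                               ≡⟨ ≡.cong (λ l → sumTo l f) (ℕₚ.m+[n∸m]≡n k≤m) ⟩
    sumTo m f                                                       ∎
    where
    d = m ℕ.∸ k
    wrap : ∀ t → f (k ℕ.+ (d ℕ.+ t)) ≈ f t
    wrap t = trans (reflexive (≡.cong f (≡.trans (≡.sym (ℕₚ.+-assoc k d t)) (≡.cong (ℕ._+ t) (ℕₚ.m+[n∸m]≡n k≤m))))) (periodic t)

  frob : ℕ → Carrier → Carrier
  frob k x = pow x (2 ℕ.^ k)

  frob-cong : ∀ k {x y} → x ≈ y → frob k x ≈ frob k y
  frob-cong k = pow-cong (2 ℕ.^ k)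

  frob-zero : ∀ x → frob 0 x ≈ x
  frob-zero = *-identityʳ

  frob-0# : ∀ k → frob k 0# ≈ 0#
  frob-0# k = pow-0# (2 ℕ.^ k) (ℕₚ.m^n>0 2 k)

  frob-* : ∀ k x y → frob k (x * y) ≈ frob k x * frob k y
  frob-* k x y = pow-distrib-* x y (2 ℕ.^ k)

  frob-frob : ∀ i j x → frob j (frob i x) ≈ frob (i ℕ.+ j) x
  frob-frob i j x = trans (pow-pow x (2 ℕ.^ i) (2 ℕ.^ j)) (reflexive (≡.cong (pow x) (≡.sym (ℕₚ.^-distribˡ-+-* 2 i j))))

  frob-periodic : ∀ i x → frob (n ℕ.+ i) x ≈ frob i x
  frob-periodic i x = trans (sym (frob-frob n i x)) (frob-cong i (fermat x))

  linearized : (ℕ → Carrier) → ℕ → Poly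
  linearized a zero    = []
  linearized a (suc m) = linearized a m ⊕ a m ·X^ (2 ℕ.^ m)

  eval-linearized : ∀ a m x → eval (linearized a m) x ≈ sumTo m (λ j → a j * frob j x)
  eval-linearized a zero    x = refl
  eval-linearized a (suc m) x = trans (eval-⊕ (linearized a m) _ x)
    (+-cong (eval-linearized a m x) (trans (eval-·X^ (a m) (2 ℕ.^ m) x) (*-congˡ (sym (pow≈^ x (2 ℕ.^ m))))))

  length-linearized : ∀ a m → length (linearized a m) ≤ 2 ℕ.^ m
  length-linearized a zero    = z≤n
  length-linearized a (suc m) = length-⊕ (linearized a m) (a m ·X^ (2 ℕ.^ m))
    (ℕₚ.≤-trans (length-linearized a m) (ℕₚ.<⇒≤ 2^m<2^[1+m]))
    (≡.subst (_≤ 2 ℕ.^ suc m) (≡.sym (length-·X^ (a m) (2 ℕ.^ m))) 2^m<2^[1+m])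
    where
    2^m<2^[1+m] : 2 ℕ.^ m < 2 ℕ.^ suc m
    2^m<2^[1+m] = ℕₚ.^-monoʳ-< 2 (s≤s (s≤s z≤n)) {m} {suc m} ℕₚ.≤-refl

  coeff-linearized : ∀ a m {j} → j < m → coeff (linearized a m) (2 ℕ.^ j) ≈ a j
  coeff-linearized a (suc m) {j} j<1+m =
    trans (coeff-⊕ (linearized a m) (a m ·X^ (2 ℕ.^ m)) (2 ℕ.^ j)) (terms (j ℕ.≟ m))
    where
    terms : Dec (j ≡ m) → coeff (linearized a m) (2 ℕ.^ j) + coeff (a m ·X^ (2 ℕ.^ m)) (2 ℕ.^ j) ≈ a j
    terms (yes ≡.refl) = trans (+-cong (coeff-beyond-length (linearized a m) (length-linearized a m)) (coeff-·X^-≡ (a m) (2 ℕ.^ m)))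
                               (+-identityˡ (a m))
    terms (no j≢m)     = trans (+-cong (coeff-linearized a m j<m) (coeff-·X^-≢ (a m) (ℕₚ.<⇒≢ (ℕₚ.^-monoʳ-< 2 (s≤s (s≤s z≤n)) j<m))))
                               (+-identityʳ (a j))
      where
      j<m : j < m
      j<m = ℕₚ.≤∧≢⇒< (ℕₚ.≤-pred j<1+m) j≢m

  -- a nonzero linearized polynomial has degree at most 2^(n-1) < q, so it cannot vanish on all of F
  linearized-vanishing⇒zero : ∀ (a : ℕ → Carrier) → (∀ x → sumTo n (λ j → a j * frob j x) ≈ 0#) → ∀ j → j < n → a j ≈ 0#
  linearized-vanishing⇒zero a vanishes j j<n =
    trans (sym (coeff-linearized a n j<n)) (coeff-IsZero linearized≈0 (2 ℕ.^ j))
    where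
    linearized≈0 : IsZero (linearized a n)
    linearized≈0 = vanishing⇒zero noZeroDivisors element element-injective (linearized a n) (length-linearized a n)
                     (λ i → trans (eval-linearized a n (element i)) (vanishes (element i)))

  module _ .{{_ : NonZero n}} where

    -- q is even, so (-1)^q = 1, while Fermat gives (-1)^q = -1
    -1≈1 : - 1# ≈ 1#
    -1≈1 = begin
      - 1#                                ≈⟨ fermat (- 1#) ⟨
      pow (- 1#) q                        ≡⟨ ≡.cong (λ k → pow (- 1#) (2 ℕ.^ k)) (ℕₚ.suc-pred n) ⟨
      pow (- 1#) (2 ℕ.* 2 ℕ.^ ℕ.pred n)   ≈⟨ pow-pow (- 1#) 2 (2 ℕ.^ ℕ.pred n) ⟨
      pow (pow (- 1#) 2) (2 ℕ.^ ℕ.pred n) ≈⟨ pow-cong (2 ℕ.^ ℕ.pred n) (*-congˡ (*-identityʳ (- 1#))) ⟩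
      pow (- 1# * - 1#) (2 ℕ.^ ℕ.pred n)  ≈⟨ pow-cong (2 ℕ.^ ℕ.pred n) (trans (-1*x≈-x (- 1#)) (-‿involutive 1#)) ⟩
      pow 1# (2 ℕ.^ ℕ.pred n)             ≈⟨ pow-1# (2 ℕ.^ ℕ.pred n) ⟩
      1#                                  ∎

    -x≈x : ∀ x → - x ≈ x
    -x≈x x = trans (sym (-1*x≈-x x)) (trans (*-congʳ -1≈1) (*-identityˡ x))

    x+x≈0 : ∀ x → x + x ≈ 0#
    x+x≈0 x = trans (+-congˡ (sym (-x≈x x))) (-‿inverseʳ x)

    x+y≈0⇒x≈y : ∀ {x y} → x + y ≈ 0# → x ≈ y
    x+y≈0⇒x≈y {x} {y} x+y≈0 = x∙y⁻¹≈ε⇒x≈y x y (trans (+-congˡ (-x≈x y)) x+y≈0)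

    square-+ : ∀ x y → pow (x + y) 2 ≈ pow x 2 + pow y 2
    square-+ x y = begin
      (x + y) * ((x + y) * 1#)             ≈⟨ *-congˡ (*-identityʳ (x + y)) ⟩
      (x + y) * (x + y)                    ≈⟨ square-expansion x y ⟩
      (x * x + y * y) + (x * y + x * y)    ≈⟨ +-congˡ (x+x≈0 (x * y)) ⟩
      (x * x + y * y) + 0#                 ≈⟨ +-identityʳ _ ⟩
      x * x + y * y                        ≈⟨ +-cong (*-congˡ (*-identityʳ x)) (*-congˡ (*-identityʳ y)) ⟨
      pow x 2 + pow y 2                    ∎

    frob-+ : ∀ k x y → frob k (x + y) ≈ frob k x + frob k y
    frob-+ zero    x y = trans (*-identityʳ _) (sym (+-cong (*-identityʳ x) (*-identityʳ y)))
    frob-+ (suc k) x y = begin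
      frob (1 ℕ.+ k) (x + y)                  ≈⟨ frob-frob 1 k (x + y) ⟨
      frob k (pow (x + y) 2)                  ≈⟨ frob-cong k (square-+ x y) ⟩
      frob k (pow x 2 + pow y 2)              ≈⟨ frob-+ k _ _ ⟩
      frob k (frob 1 x) + frob k (frob 1 y)   ≈⟨ +-cong (frob-frob 1 k x) (frob-frob 1 k y) ⟩
      frob (1 ℕ.+ k) x + frob (1 ℕ.+ k) y     ∎

    frob-sumTo : ∀ k m (f : ℕ → Carrier) → frob k (sumTo m f) ≈ sumTo m (λ i → frob k (f i))
    frob-sumTo k zero    f = frob-0# k
    frob-sumTo k (suc m) f = trans (frob-+ k _ _) (+-congʳ (frob-sumTo k m f))

    frob-injective : ∀ k {x y} → frob k x ≈ frob k y → x ≈ y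
    frob-injective k {x} {y} fx≈fy with (x + y) ≟ 0#
    ... | yes x+y≈0 = x+y≈0⇒x≈y x+y≈0
    ... | no  x+y≉0 = ⊥-elim (pow-nonzero (2 ℕ.^ k) x+y≉0 (begin
      frob k (x + y)          ≈⟨ frob-+ k x y ⟩
      frob k x + frob k y     ≈⟨ +-congʳ fx≈fy ⟩
      frob k y + frob k y     ≈⟨ x+x≈0 _ ⟩
      0#                      ∎))

    Tr-cong : ∀ {x y} → x ≈ y → Tr x ≈ Tr y
    Tr-cong x≈y = sumTo-cong n (λ i _ → frob-cong i x≈y)

    Tr-+ : ∀ x y → Tr (x + y) ≈ Tr x + Tr y
    Tr-+ x y = trans (sumTo-cong n (λ i _ → frob-+ i x y)) (sumTo-+ n _ _)

    Tr-sumTo : ∀ m (f : ℕ → Carrier) → Tr (sumTo m f) ≈ sumTo m (λ i → Tr (f i))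
    Tr-sumTo zero    f = sumTo-zero n (λ i _ → frob-0# i)
    Tr-sumTo (suc m) f = trans (Tr-+ _ _) (+-congʳ (Tr-sumTo m f))

    Tr-frob : ∀ k x → k ≤ n → Tr (frob k x) ≈ Tr x
    Tr-frob k x k≤n = trans (sumTo-cong n (λ i _ → frob-frob k i x))
                            (sumTo-rotate n k (λ i → frob i x) k≤n (λ i → frob-periodic i x))

    linearized-coefficients-unique : ∀ (a b : ℕ → Carrier) →
                                     (∀ x → sumTo n (λ j → a j * frob j x) ≈ sumTo n (λ j → b j * frob j x)) →
                                     ∀ j → j < n → a j ≈ b j
    linearized-coefficients-unique a b a≈b j j<n = x+y≈0⇒x≈y (linearized-vanishing⇒zero (λ j → a j + b j) difference j j<n)
      where
      difference : ∀ x → sumTo n (λ j → (a j + b j) * frob j x) ≈ 0#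
      difference x = begin
        sumTo n (λ j → (a j + b j) * frob j x)                             ≈⟨ sumTo-cong n (λ j _ → distribʳ (frob j x) (a j) (b j)) ⟩
        sumTo n (λ j → a j * frob j x + b j * frob j x)                    ≈⟨ sumTo-+ n _ _ ⟩
        sumTo n (λ j → a j * frob j x) + sumTo n (λ j → b j * frob j x)   ≈⟨ +-congʳ (a≈b x) ⟩
        sumTo n (λ j → b j * frob j x) + sumTo n (λ j → b j * frob j x)   ≈⟨ x+x≈0 _ ⟩
        0#                                                                 ∎

    Tr-nondegenerate : ∀ {d} → (∀ v → Tr (d * v) ≈ 0#) → d ≈ 0#
    Tr-nondegenerate {d} Tr[dv]≈0 with d ≟ 0#
    ... | yes d≈0 = d≈0
    ... | no  d≉0 with invertible d d≉0
    ... | d⁻¹ , dd⁻¹≈1 = ⊥-elim (nontrivial (linearized-vanishing⇒zero (λ _ → 1#) Tr≈0 0 (ℕ.>-nonZero⁻¹ n)))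
      where
      Tr≈0 : ∀ w → sumTo n (λ j → 1# * frob j w) ≈ 0#
      Tr≈0 w = begin
        sumTo n (λ j → 1# * frob j w) ≈⟨ sumTo-cong n (λ j _ → *-identityˡ (frob j w)) ⟩
        Tr w                          ≈⟨ Tr-cong (trans (sym (*-identityˡ w)) (*-congʳ (sym dd⁻¹≈1))) ⟩
        Tr (d * d⁻¹ * w)              ≈⟨ Tr-cong (*-assoc d d⁻¹ w) ⟩
        Tr (d * (d⁻¹ * w))            ≈⟨ Tr[dv]≈0 (d⁻¹ * w) ⟩
        0#                            ∎

    adjoint-unique : ∀ (A B : Carrier → Carrier) → (∀ u v → Tr (A u * v) ≈ Tr (B u * v)) → ∀ u → A u ≈ B u
    adjoint-unique A B adjoint u = x+y≈0⇒x≈y (Tr-nondegenerate λ v → begin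
      Tr ((A u + B u) * v)          ≈⟨ Tr-cong (distribʳ v (A u) (B u)) ⟩
      Tr (A u * v + B u * v)        ≈⟨ Tr-+ _ _ ⟩
      Tr (A u * v) + Tr (B u * v)   ≈⟨ +-congʳ (adjoint u v) ⟩
      Tr (B u * v) + Tr (B u * v)   ≈⟨ x+x≈0 _ ⟩
      0#                            ∎)

module LinearizedPolynomial {n : ℕ} .{{_ : NonZero n}} {κ ℓ : Level} (F : FiniteField2^ n κ ℓ) (cs : Fin n → FiniteField2^.Carrier F) where
  open FiniteField2^ F
  open FieldOps F
  open FiniteField2^Properties F
  open import Relation.Binary.Reasoning.Setoid setoid
  open import Algebra.Properties.CommutativeSemigroup *-commutativeSemigroup using (xy∙z≈y∙xz)
  open import Algebra.Properties.CommutativeSemigroup ℕₚ.+-commutativeSemigroup using () renaming (xy∙z≈xz∙y to [k+j]+d≡[k+d]+j)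

  c : ℕ → Carrier
  c i = cs (modIdx i)

  c-periodic : ∀ i → c (n ℕ.+ i) ≡ c i
  c-periodic i = ≡.cong cs (Fin.fromℕ<-cong _ _ (≡.trans (≡.cong (ℕ._% n) (ℕₚ.+-comm n i)) ([m+n]%n≡m%n i n)) _ _)

  L : Carrier → Carrier
  L = linPoly cs

  L* : Carrier → Carrier
  L* u = sumTo n (λ k → frob (n ℕ.∸ k) (c k * u))

  L-cong : ∀ {x y} → x ≈ y → L x ≈ L y
  L-cong x≈y = sumTo-cong n (λ i _ → *-congˡ (frob-cong i x≈y))

  L*-cong : ∀ {x y} → x ≈ y → L* x ≈ L* y
  L*-cong x≈y = sumTo-cong n (λ k _ → frob-cong (n ℕ.∸ k) (*-congˡ x≈y))

  -- Tr is invariant under the Frobenius frob k, which inverts frob (n ∸ k) termwise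
  L*-adjoint : ∀ u v → Tr (L* u * v) ≈ Tr (u * L v)
  L*-adjoint u v = begin
    Tr (L* u * v)                                          ≈⟨ Tr-cong (*-distribʳ-sumTo n v _) ⟩
    Tr (sumTo n (λ k → frob (n ℕ.∸ k) (c k * u) * v))      ≈⟨ Tr-sumTo n _ ⟩
    sumTo n (λ k → Tr (frob (n ℕ.∸ k) (c k * u) * v))      ≈⟨ sumTo-cong n term ⟩
    sumTo n (λ k → Tr (u * (c k * frob k v)))              ≈⟨ Tr-sumTo n _ ⟨
    Tr (sumTo n (λ k → u * (c k * frob k v)))              ≈⟨ Tr-cong (*-distribˡ-sumTo n u _) ⟨
    Tr (u * L v)                                           ∎
    where
    term : ∀ k → k < n → Tr (frob (n ℕ.∸ k) (c k * u) * v) ≈ Tr (u * (c k * frob k v))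
    term k k<n = begin
      Tr (frob (n ℕ.∸ k) (c k * u) * v)                      ≈⟨ Tr-frob k _ (ℕₚ.<⇒≤ k<n) ⟨
      Tr (frob k (frob (n ℕ.∸ k) (c k * u) * v))             ≈⟨ Tr-cong (frob-* k _ v) ⟩
      Tr (frob k (frob (n ℕ.∸ k) (c k * u)) * frob k v)      ≈⟨ Tr-cong (*-congʳ (frob-frob (n ℕ.∸ k) k _)) ⟩
      Tr (frob (n ℕ.∸ k ℕ.+ k) (c k * u) * frob k v)         ≡⟨ ≡.cong (λ m → Tr (frob m (c k * u) * frob k v)) (ℕₚ.m∸n+n≡m (ℕₚ.<⇒≤ k<n)) ⟩
      Tr (frob n (c k * u) * frob k v)                       ≈⟨ Tr-cong (*-congʳ (fermat _)) ⟩
      Tr (c k * u * frob k v)                                ≈⟨ Tr-cong (xy∙z≈y∙xz (c k) u _) ⟩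
      Tr (u * (c k * frob k v))                              ∎

  b : ℕ → Carrier
  b j = sumTo n (λ i → frob (n ℕ.∸ i) (c i * c (i ℕ.+ j)))

  -- after Frobenius expansion the (k , i) term carries frob (i + (n ∸ k)) x; substituting i = k + j turns it into frob j x
  L*∘L : ∀ x → L* (L x) ≈ sumTo n (λ j → b j * frob j x)
  L*∘L x = begin
    L* (L x)                                                 ≈⟨ sumTo-cong n (λ k _ → expand k) ⟩
    sumTo n (λ k → sumTo n (term k))                          ≈⟨ sumTo-cong n (λ k k<n → sumTo-rotate n k (term k) (ℕₚ.<⇒≤ k<n) (term-periodic k)) ⟨
    sumTo n (λ k → sumTo n (λ j → term k (k ℕ.+ j)))          ≈⟨ sumTo-cong n (λ k k<n → sumTo-cong n (λ j _ → shift k j (ℕₚ.<⇒≤ k<n))) ⟩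
    sumTo n (λ k → sumTo n (λ j → frob (n ℕ.∸ k) (c k * c (k ℕ.+ j)) * frob j x)) ≈⟨ sumTo-swap n n _ ⟩
    sumTo n (λ j → sumTo n (λ k → frob (n ℕ.∸ k) (c k * c (k ℕ.+ j)) * frob j x)) ≈⟨ sumTo-cong n (λ j _ → *-distribʳ-sumTo n (frob j x) _) ⟨
    sumTo n (λ j → b j * frob j x)                           ∎
    where
    term : ℕ → ℕ → Carrier
    term k i = frob (n ℕ.∸ k) (c k * c i) * frob (i ℕ.+ (n ℕ.∸ k)) x

    expand : ∀ k → frob (n ℕ.∸ k) (c k * L x) ≈ sumTo n (term k)
    expand k = begin
      frob (n ℕ.∸ k) (c k * L x)                                         ≈⟨ frob-cong (n ℕ.∸ k) (*-distribˡ-sumTo n (c k) _) ⟩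
      frob (n ℕ.∸ k) (sumTo n (λ i → c k * (c i * frob i x)))            ≈⟨ frob-sumTo (n ℕ.∸ k) n _ ⟩
      sumTo n (λ i → frob (n ℕ.∸ k) (c k * (c i * frob i x)))            ≈⟨ sumTo-cong n (λ i _ → frob-cong (n ℕ.∸ k) (sym (*-assoc (c k) (c i) _))) ⟩
      sumTo n (λ i → frob (n ℕ.∸ k) (c k * c i * frob i x))              ≈⟨ sumTo-cong n (λ i _ → frob-* (n ℕ.∸ k) _ _) ⟩
      sumTo n (λ i → frob (n ℕ.∸ k) (c k * c i) * frob (n ℕ.∸ k) (frob i x)) ≈⟨ sumTo-cong n (λ i _ → *-congˡ (frob-frob i (n ℕ.∸ k) x)) ⟩
      sumTo n (term k)                                                   ∎

    term-periodic : ∀ k i → term k (n ℕ.+ i) ≈ term k i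
    term-periodic k i = *-cong (reflexive (≡.cong (λ cᵢ → frob (n ℕ.∸ k) (c k * cᵢ)) (c-periodic i)))
                               (trans (reflexive (≡.cong (λ m → frob m x) (ℕₚ.+-assoc n i (n ℕ.∸ k)))) (frob-periodic _ x))

    shift : ∀ k j → k ≤ n → term k (k ℕ.+ j) ≈ frob (n ℕ.∸ k) (c k * c (k ℕ.+ j)) * frob j x
    shift k j k≤n = *-congˡ (trans (reflexive (≡.cong (λ m → frob m x) k+j+[n∸k]≡n+j)) (frob-periodic j x))
      where
      k+j+[n∸k]≡n+j : k ℕ.+ j ℕ.+ (n ℕ.∸ k) ≡ n ℕ.+ j
      k+j+[n∸k]≡n+j = ≡.trans ([k+j]+d≡[k+d]+j k j (n ℕ.∸ k)) (≡.cong (ℕ._+ j) (ℕₚ.m+[n∸m]≡n k≤n))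

  δ₀ : ℕ → Carrier
  δ₀ zero    = 1#
  δ₀ (suc _) = 0#

  sumTo-δ₀ : ∀ x → sumTo n (λ j → δ₀ j * frob j x) ≈ x
  sumTo-δ₀ x = trans (sumTo-head n λ { (suc i) _ _ → zeroˡ (frob (suc i) x) }) (trans (*-identityˡ _) (frob-zero x))

  b₀≈frob1 : b 0 ≈ frob 1 (sumTo n (λ i → frob (n ℕ.∸ i) (c i)))
  b₀≈frob1 = begin
    b 0                                                        ≈⟨ sumTo-cong n (λ i _ → square i) ⟩
    sumTo n (λ i → frob 1 (frob (n ℕ.∸ i) (c i)))               ≈⟨ frob-sumTo 1 n _ ⟨
    frob 1 (sumTo n (λ i → frob (n ℕ.∸ i) (c i)))               ∎
    where
    square : ∀ i → frob (n ℕ.∸ i) (c i * c (i ℕ.+ 0)) ≈ frob 1 (frob (n ℕ.∸ i) (c i))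
    square i = begin
      frob (n ℕ.∸ i) (c i * c (i ℕ.+ 0))       ≡⟨ ≡.cong (λ m → frob (n ℕ.∸ i) (c i * c m)) (ℕₚ.+-identityʳ i) ⟩
      frob (n ℕ.∸ i) (c i * c i)               ≈⟨ frob-* (n ℕ.∸ i) (c i) (c i) ⟩
      frob (n ℕ.∸ i) (c i) * frob (n ℕ.∸ i) (c i) ≈⟨ *-congˡ (*-identityʳ _) ⟨
      frob 1 (frob (n ℕ.∸ i) (c i))            ∎

  coeffConditions⇔ : CoeffConditions cs ⇔ (∀ j → j < n → b j ≈ δ₀ j)
  coeffConditions⇔ = mk⇔ to from
    where
    to : CoeffConditions cs → ∀ j → j < n → b j ≈ δ₀ j
    to (S≈1 , _)   zero    _   = trans b₀≈frob1 (trans (frob-cong 1 S≈1) (pow-1# 2))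
    to (_   , b≈0) (suc j) j<n = b≈0 (suc j) (s≤s z≤n) j<n
    from : (∀ j → j < n → b j ≈ δ₀ j) → CoeffConditions cs
    from b≈δ₀ = frob-injective 1 (trans (sym b₀≈frob1) (trans (b≈δ₀ 0 (ℕ.>-nonZero⁻¹ n)) (sym (pow-1# 2))))
              , λ { (suc j) _ j<n → b≈δ₀ (suc j) j<n }

  L*∘L≈id⇔ : (∀ x → L* (L x) ≈ x) ⇔ (∀ j → j < n → b j ≈ δ₀ j)
  L*∘L≈id⇔ = mk⇔ to from
    where
    to : (∀ x → L* (L x) ≈ x) → ∀ j → j < n → b j ≈ δ₀ j
    to L*L≈id = linearized-coefficients-unique b δ₀ (λ x → trans (sym (L*∘L x)) (trans (L*L≈id x) (sym (sumTo-δ₀ x))))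
    from : (∀ j → j < n → b j ≈ δ₀ j) → ∀ x → L* (L x) ≈ x
    from b≈δ₀ x = trans (L*∘L x) (trans (sumTo-cong n (λ j j<n → *-congʳ (b≈δ₀ j j<n))) (sumTo-δ₀ x))

  invertibleAndSelfAdjointInverse⇔ : InvertibleAndSelfAdjointInverse L ⇔ (∀ x → L* (L x) ≈ x)
  invertibleAndSelfAdjointInverse⇔ = mk⇔ to from
    where
    to : InvertibleAndSelfAdjointInverse L → ∀ x → L* (L x) ≈ x
    to (L⁻¹ , _ , L⁻¹L≈id , adjoint) x =
      trans (adjoint-unique L* L⁻¹ (λ u v → trans (L*-adjoint u v) (sym (adjoint u v))) (L x)) (L⁻¹L≈id x)
    from : (∀ x → L* (L x) ≈ x) → InvertibleAndSelfAdjointInverse L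
    from L*L≈id = L* , LL*≈id , L*L≈id , L*-adjoint
      where
      L-injective : ∀ {x y} → L x ≈ L y → x ≈ y
      L-injective {x} {y} Lx≈Ly = trans (sym (L*L≈id x)) (trans (L*-cong Lx≈Ly) (L*L≈id y))
      LL*≈id : ∀ y → L (L* y) ≈ y
      LL*≈id y with injective⇒surjective L L-cong L-injective y
      ... | x , Lx≈y = trans (L-cong (L*-cong (sym Lx≈y))) (trans (L-cong (L*L≈id x)) Lx≈y)

proposition6p20 : {c ℓ : Level} (n : ℕ) .{{_ : NonZero n}} (F : FiniteField2^ n c ℓ)
    (cs : Fin n → FiniteField2^.Carrier F)
    → FieldOps.InvertibleAndSelfAdjointInverse F (FieldOps.linPoly F cs) ⇔ FieldOps.CoeffConditions F cs
proposition6p20 n F cs = ⇔-trans invertibleAndSelfAdjointInverse⇔ (⇔-trans L*∘L≈id⇔ (⇔-sym coeffConditions⇔))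
  where open LinearizedPolynomial F cs
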